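{- Let $\mathcal{P}$ be a finite set of atomic propositions and let $n\in\mathbb{N}$. For all inquisitive modal models $\mathcal{M}=(W,\Sigma,V)$ and $\mathcal{M}'=(W',\Sigma',V')$ over $\mathcal{P}$, all information states $s\subseteq W$, $s'\subseteq W'$ and all worlds $w\in W$, $w'\in W'$: (i) $\mathcal{M},s\sim^n\mathcal{M}',s'$ if and only if $\mathcal{M},s\equiv^n_{\mathrm{InqML}}\mathcal{M}',s'$; (ii) $\mathcal{M},w\sim^n\mathcal{M}',w'$ if and only if $\mathcal{M},w\equiv^n_{\mathrm{InqML}}\mathcal{M}',w'$.
   Context: An inquisitive modal model over a set $\mathcal{P}$ of atoms is a triple $\mathcal{M}=(W,\Sigma,V)$ where $W$ is a set (of worlds), $V:\mathcal{P}\to\wp(W)$, and $\Sigma:W\to\wp\wp(W)$ assigns to each world a non-empty, downward closed (under subsets) set $\Sigma(w)$ of subsets of $W$. Subsets of $W$ are called information states. Put $\sigma(w):=\bigcup\Sigma(w)$. Formulae of InqML: $\varphi::=p\mid\bot\mid(\varphi\wedge\varphi)\mid(\varphi\to\varphi)\mid(\varphi\,\bar\vee\,\varphi)\mid\Box\varphi\mid\boxplus\varphi$ with $p\in\mathcal{P}$ ($\bar\vee$ is "inquisitive disjunction"); $\neg\varphi:=\varphi\to\bot$, $\varphi\vee\psi:=\neg(\neg\varphi\wedge\neg\psi)$. Support at a state $s\subseteq W$: $\mathcal{M},s\models p$ iff $s\subseteq V(p)$; $\mathcal{M},s\models\bot$ iff $s=\emptyset$; $\wedge$ is conjunction of support;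 $\mathcal{M},s\models\varphi\to\psi$ iff for all $t\subseteq s$, $\mathcal{M},t\models\varphi$ implies $\mathcal{M},t\models\psi$; $\mathcal{M},s\models\varphi\bar\vee\psi$ iff $\mathcal{M},s\models\varphi$ or $\mathcal{M},s\models\psi$; $\mathcal{M},s\models\Box\varphi$ iff $\mathcal{M},\sigma(w)\models\varphi$ for all $w\in s$; $\mathcal{M},s\models\boxplus\varphi$ iff $\mathcal{M},t\models\varphi$ for all $w\in s$ and all $t\in\Sigma(w)$. Truth at a world: $\mathcal{M},w\models\varphi$ iff $\mathcal{M},\{w\}\models\varphi$. The modal depth of a formula is the maximal nesting of the modalities $\Box,\boxplus$; $\mathrm{InqML}_n$ is the set of formulae of modal depth $\le n$. $\mathcal{M},s\equiv^n_{\mathrm{InqML}}\mathcal{M}',s'$ means that for all $\varphi\in\mathrm{InqML}_n$, $\mathcal{M},s\models\varphi\iff\mathcal{M}',s'\models\varphi$; analogously for worlds (using truth). Bisimulation game between $\mathcal{M}$ and $\mathcal{M}'$: positions are world-positions $(w,w')\in W\times W'$ or state-positions $(s,s')\in\wp(W)\times\wp(W')$. From a world-position, player I picks $s\in\Sigma(w)$ or $s'\in\Sigma'(w')$ and player II must answer with a state in $\Sigma'(w')$ resp. $\Sigma(w)$ on the other side, giving a state-position $(s,s')$. From a state-position, I picks a world in $s$ or in $s'$ and II must answer with a world in the other state, giving a world-position. A round consists of these four moves leading from a world-position to a world-position. A player who cannot move loses; II loses at any world-position $(w,w')$ where $w,w'$ disagree on some atom $p$ (i.e. $w\in V(p)\not\Leftrightarrow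 w'\in V'(p)$); all other plays (including those ending after the prescribed number of rounds and infinite plays) are won by II. $\mathcal{M},w\sim^n\mathcal{M}',w'$ iff II has a winning strategy in the $n$-round game starting at $(w,w')$. For states, $\mathcal{M},s\sim^n\mathcal{M}',s'$ iff every world of $s$ is $n$-bisimilar to some world of $s'$ and vice versa. -}

module Defs where

open import Level using (Level; 0ℓ) renaming (suc to lsuc)
open import Data.Nat using (ℕ; zero; suc; _⊔_; _≤_)
open import Data.Fin using (Fin)
open import Data.Product using (Σ; ∃; _×_; _,_)
open import Function.Bundles using (_⇔_)
open import Relation.Binary.PropositionalEquality using (_≡_)
open import Data.Empty using (⊥)

State : Set → Set₁
State W = W → Set

_⊆_ : {W : Set} → State W → State W → Set
s ⊆ t = ∀ x → s x → t x

⟦_⟧ : {W : Set} → W → State W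
⟦ w ⟧ = λ v → v ≡ w

-- Inquisitive modal models over the atom set Fin k (a finite set P).
-- σ(w) = ⋃ Σ(w) is included as a field together with its defining law
-- (needed only for universe-level reasons: the union would otherwise
-- live one universe up).

record Model (k : ℕ) : Set₁ where
  field
    W       : Set
    Σw      : W → State W → Set
    V       : Fin k → State W
    Σ-nonempty  : ∀ w → ∃ λ (s : State W) → Σw w s
    Σ-downward  : ∀ w s t → t ⊆ s → Σw w s → Σw w t
    σ       : W → State W
    σ-def   : ∀ w v → σ w v ⇔ (∃ λ (t : State W) → Σw w t × t v)

open Model public

data Form (k : ℕ) : Set where
  atom : Fin k → Form k
  falsum : Form k
  _∧ᶠ_ : Form k → Form k → Form k
  _⇒ᶠ_ : Form k → Form k → Form k
  _⩒_  : Form k → Form k → Form k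
  □_   : Form k → Form k
  ⊞_   : Form k → Form k

md : ∀ {k} → Form k → ℕ
md (atom p) = 0
md falsum = 0
md (φ ∧ᶠ ψ) = md φ ⊔ md ψ
md (φ ⇒ᶠ ψ) = md φ ⊔ md ψ
md (φ ⩒ ψ) = md φ ⊔ md ψ
md (□ φ) = suc (md φ)
md (⊞ φ) = suc (md φ)

_,_⊨_ : ∀ {k} (M : Model k) → State (W M) → Form k → Set₁
M , s ⊨ atom p = Level.Lift (lsuc 0ℓ) (s ⊆ V M p)
M , s ⊨ falsum = Level.Lift (lsuc 0ℓ) (∀ x → s x → ⊥)
M , s ⊨ (φ ∧ᶠ ψ) = (M , s ⊨ φ) × (M , s ⊨ ψ)
M , s ⊨ (φ ⇒ᶠ ψ) = ∀ t → t ⊆ s → M , t ⊨ φ → M , t ⊨ ψ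
M , s ⊨ (φ ⩒ ψ) = (M , s ⊨ φ) Data.Sum.⊎ (M , s ⊨ ψ)
  where import Data.Sum
M , s ⊨ (□ φ) = ∀ w → s w → M , σ M w ⊨ φ
M , s ⊨ (⊞ φ) = ∀ w → s w → ∀ t → Σw M w t → M , t ⊨ φ

_,_⊨w_ : ∀ {k} (M : Model k) → W M → Form k → Set₁
M , w ⊨w φ = M , ⟦ w ⟧ ⊨ φ

≡InqML-state : ∀ {k} (n : ℕ) (M M′ : Model k) → State (W M) → State (W M′) → Set₁
≡InqML-state n M M′ s s′ = ∀ φ → md φ ≤ n → (M , s ⊨ φ) ⇔ (M′ , s′ ⊨ φ)

≡InqML-world : ∀ {k} (n : ℕ) (M M′ : Model k) → W M → W M′ → Set₁
≡InqML-world n M M′ w w′ = ∀ φ → md φ ≤ n → (M , w ⊨w φ) ⇔ (M′ , w′ ⊨w φ)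

-- The bisimulation game.  `WinWorld n M M′ w w′` : player II has a winning
-- strategy in the n-round game from world-position (w,w′);
-- `WinState n M M′ s s′` : II has a winning strategy from state-position
-- (s,s′) when n full rounds remain after reaching the next world-position.
-- A strategy for II is encoded by the witnesses of the existentials
-- (her answers); universal quantification ranges over I's moves.

AtomAgree : ∀ {k} (M M′ : Model k) → W M → W M′ → Set
AtomAgree M M′ w w′ = ∀ p → (V M p w ⇔ V M′ p w′)

mutual
  WinWorld : ∀ {k} (n : ℕ) (M M′ : Model k) → W M → W M′ → Set₁
  WinWorld zero M M′ w w′ = Level.Lift (lsuc 0ℓ) (AtomAgree M M′ w w′)
  WinWorld (suc n) M M′ w w′ =
    Level.Lift (lsuc 0ℓ) (AtomAgree M M′ w w′)
    × (∀ s → Σw M w s → ∃ λ (s′ : State (W M′)) → Σw M′ w′ s′ × WinState n M M′ s s′)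
    × (∀ s′ → Σw M′ w′ s′ → ∃ λ (s : State (W M)) → Σw M w s × WinState n M M′ s s′)

  WinState : ∀ {k} (n : ℕ) (M M′ : Model k) → State (W M) → State (W M′) → Set₁
  WinState n M M′ s s′ =
    (∀ x → s x → ∃ λ x′ → s′ x′ × WinWorld n M M′ x x′)
    × (∀ x′ → s′ x′ → ∃ λ x → s x × WinWorld n M M′ x x′)

Bisim-world : ∀ {k} (n : ℕ) (M M′ : Model k) → W M → W M′ → Set₁
Bisim-world = WinWorld

Bisim-state : ∀ {k} (n : ℕ) (M M′ : Model k) → State (W M) → State (W M′) → Set₁
Bisim-state n M M′ s s′ =
  (∀ x → s x → ∃ λ x′ → s′ x′ × Bisim-world n M M′ x x′)
  × (∀ x′ → s′ x′ → ∃ λ x → s x × Bisim-world n M M′ x x′)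

-- Invariance: by induction on φ, an n-round winning strategy between s and s′ transports
-- support of formulas of depth ≤ n; for φ ⇒ ψ one restricts s to the worlds matched by a
-- substate t′ ⊆ s′, which keeps the winning strategy.
--
-- Characterisation: with finitely many atoms, the tests of depth n + 1 are the atoms together
-- with ⊞ (⩒_{χ ∈ S} ¬ χ) for every set S of depth-n characters, and a character is a
-- conjunction deciding every test. Worlds sharing a depth-n character are n-bisimilar: given
-- s ∈ Σ(w), let S be the characters realised in s. Then w fails ⊞ (⩒_{χ ∈ S} ¬ χ), so w′ fails
-- it too and some t′ ∈ Σ(w′) realises every χ ∈ S; the worlds of t′ realising some χ ∈ S
-- answer s. Equivalent states realise the same characters, since s supports ¬ χ iff no world
-- of s has character χ.

module Submission where

open import Defs
open import Level using (0ℓ; lift; lower) renaming (suc to lsuc)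
open import Data.Nat using (ℕ; zero; suc; _≤_; z≤n; s≤s)
open import Data.Nat.Properties using (⊔-lub; m⊔n≤o⇒m≤o; m⊔n≤o⇒n≤o)
open import Data.Product using (_×_; ∃; _,_; proj₁; proj₂)
open import Data.Bool using (true; false)
open import Data.Sum using (_⊎_; inj₁; inj₂)
open import Data.List using (List; []; _∷_; [_]; map; _++_; filter; allFin; cartesianProductWith)
open import Data.List.Membership.Propositional using (_∈_)
open import Data.List.Membership.Propositional.Properties
  using (∈-map⁺; ∈-map⁻; ∈-++⁺ˡ; ∈-++⁺ʳ; ∈-++⁻; ∈-allFin; ∈-filter⁺; ∈-filter⁻;
         ∈-cartesianProductWith⁺; ∈-cartesianProductWith⁻)
open import Data.List.Relation.Unary.Any using (here; there)
open import Data.Empty using (⊥-elim)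
open import Relation.Nullary using (yes; no; ¬_; does)
open import Relation.Nullary.Decidable using (True; toWitness; fromWitness; decidable-stable)
open import Relation.Unary using (Pred; Decidable; ∅; _∩_)
open import Relation.Binary.PropositionalEquality using (refl; sym; subst)
open import Function.Base using (_∘_)
open import Function.Bundles using (_⇔_; mk⇔; Equivalence)
open import Function.Properties.Equivalence using () renaming (sym to ⇔-sym)
open import Axiom.ExcludedMiddle using (ExcludedMiddle)

module _ {a} {A : Set a} where

  sublists : List A → List (List A)
  sublists [] = [ [] ]
  sublists (x ∷ xs) = map (x ∷_) (sublists xs) ++ sublists xs

  ∈-sublists⇒⊆ : ∀ {xs ys z} → ys ∈ sublists xs → z ∈ ys → z ∈ xs
  ∈-sublists⇒⊆ {[]} (here refl) ()
  ∈-sublists⇒⊆ {x ∷ xs} ys∈ z∈ys with ∈-++⁻ (map (x ∷_) (sublists xs)) ys∈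
  ... | inj₂ ys∈′ = there (∈-sublists⇒⊆ ys∈′ z∈ys)
  ... | inj₁ ys∈′ with ∈-map⁻ (x ∷_) ys∈′
  ...   | zs , zs∈ , refl with z∈ys
  ...     | here refl = here refl
  ...     | there z∈zs = there (∈-sublists⇒⊆ zs∈ z∈zs)

  filter∈sublists : ∀ {p} {P : Pred A p} (P? : Decidable P) xs → filter P? xs ∈ sublists xs
  filter∈sublists P? [] = here refl
  filter∈sublists P? (x ∷ xs) with does (P? x)
  ... | true  = ∈-++⁺ˡ (∈-map⁺ (x ∷_) (filter∈sublists P? xs))
  ... | false = ∈-++⁺ʳ (map (x ∷_) (sublists xs)) (filter∈sublists P? xs)

⟦⟧⊆ : ∀ {A : Set} {s : State A} {x} → s x → ⟦ x ⟧ ⊆ s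
⟦⟧⊆ {s = s} sx y y≡x = subst s (sym y≡x) sx

module _ {k : ℕ} where

  infix 25 ¬ᶠ_
  ¬ᶠ_ : Form k → Form k
  ¬ᶠ φ = φ ⇒ᶠ falsum

  ⊤ᶠ : Form k
  ⊤ᶠ = ¬ᶠ falsum

  md-¬ : ∀ φ {n} → md φ ≤ n → md (¬ᶠ φ) ≤ n
  md-¬ φ d = ⊔-lub d z≤n

  ⊨-persistent : ∀ (M : Model k) φ {s t} → t ⊆ s → M , s ⊨ φ → M , t ⊨ φ
  ⊨-persistent M (atom p) t⊆s (lift s⊆p) = lift (λ x tx → s⊆p x (t⊆s x tx))
  ⊨-persistent M falsum   t⊆s (lift s⊆∅) = lift (λ x tx → s⊆∅ x (t⊆s x tx))
  ⊨-persistent M (φ ∧ᶠ ψ) t⊆s (sφ , sψ)  = ⊨-persistent M φ t⊆s sφ , ⊨-persistent M ψ t⊆s sψ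
  ⊨-persistent M (φ ⇒ᶠ ψ) t⊆s s⊨         = λ u u⊆t → s⊨ u (λ x ux → t⊆s x (u⊆t x ux))
  ⊨-persistent M (φ ⩒ ψ)  t⊆s (inj₁ sφ)  = inj₁ (⊨-persistent M φ t⊆s sφ)
  ⊨-persistent M (φ ⩒ ψ)  t⊆s (inj₂ sψ)  = inj₂ (⊨-persistent M ψ t⊆s sψ)
  ⊨-persistent M (□ φ)    t⊆s s⊨         = λ w tw → s⊨ w (t⊆s w tw)
  ⊨-persistent M (⊞ φ)    t⊆s s⊨         = λ w tw → s⊨ w (t⊆s w tw)

  ⊨¬-intro : ∀ (M : Model k) {t φ} → (∀ x → t x → ¬ (M , ⟦ x ⟧ ⊨ φ)) → M , t ⊨ ¬ᶠ φ
  ⊨¬-intro M {φ = φ} none u u⊆t uφ =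
    lift (λ x ux → none x (u⊆t x ux) (⊨-persistent M φ (⟦⟧⊆ ux) uφ))

  ⊨¬-elim : ∀ (M : Model k) {t φ x} → M , t ⊨ ¬ᶠ φ → t x → ¬ (M , ⟦ x ⟧ ⊨ φ)
  ⊨¬-elim M {x = x} t⊨¬φ tx xφ = lower (t⊨¬φ ⟦ x ⟧ (⟦⟧⊆ tx) xφ) x refl

  Σ-∅ : ∀ (M : Model k) w → Σw M w ∅
  Σ-∅ M w = Σ-downward M w _ ∅ (λ _ ()) (proj₂ (Σ-nonempty M w))

  literals : Form k → List (Form k)
  literals ψ = ψ ∷ ¬ᶠ ψ ∷ []

  profiles : List (Form k) → List (Form k)
  profiles [] = [ ⊤ᶠ ]
  profiles (ψ ∷ L) = cartesianProductWith _∧ᶠ_ (literals ψ) (profiles L)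

  ∈-profiles⁺ : ∀ {ψ} L {l χ} → l ∈ literals ψ → χ ∈ profiles L → l ∧ᶠ χ ∈ profiles (ψ ∷ L)
  ∈-profiles⁺ _ = ∈-cartesianProductWith⁺ _∧ᶠ_

  omitsSome : List (Form k) → Form k
  omitsSome [] = falsum
  omitsSome (χ ∷ S) = (¬ᶠ χ) ⩒ omitsSome S

  atoms : List (Form k)
  atoms = map atom (allFin k)

  tests : ℕ → List (Form k)
  tests zero = atoms
  tests (suc n) = atoms ++ map (⊞_ ∘ omitsSome) (sublists (profiles (tests n)))

  characters : ℕ → List (Form k)
  characters n = profiles (tests n)

  DepthBounded : ℕ → List (Form k) → Set
  DepthBounded n L = ∀ {φ} → φ ∈ L → md φ ≤ n

  profiles-depth : ∀ {n} L → DepthBounded n L → DepthBounded n (profiles L)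
  profiles-depth [] _ (here refl) = z≤n
  profiles-depth (ψ ∷ L) d χ∈ with ∈-cartesianProductWith⁻ _∧ᶠ_ (literals ψ) (profiles L) χ∈
  ... | _ , χ₀ , here refl , χ₀∈ , refl =
    ⊔-lub (d (here refl)) (profiles-depth L (d ∘ there) χ₀∈)
  ... | _ , χ₀ , there (here refl) , χ₀∈ , refl =
    ⊔-lub (md-¬ ψ (d (here refl))) (profiles-depth L (d ∘ there) χ₀∈)

  omitsSome-depth : ∀ {n} S → DepthBounded n S → md (omitsSome S) ≤ n
  omitsSome-depth [] _ = z≤n
  omitsSome-depth (χ ∷ S) d = ⊔-lub (md-¬ χ (d (here refl))) (omitsSome-depth S (d ∘ there))

  atoms-depth : ∀ {n} → DepthBounded n atoms
  atoms-depth φ∈ with ∈-map⁻ atom φ∈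
  ... | _ , _ , refl = z≤n

  tests-depth : ∀ n → DepthBounded n (tests n)
  tests-depth zero = atoms-depth
  tests-depth (suc n) φ∈ with ∈-++⁻ atoms φ∈
  ... | inj₁ φ∈atoms = atoms-depth φ∈atoms
  ... | inj₂ φ∈boxes with ∈-map⁻ (⊞_ ∘ omitsSome) φ∈boxes
  ...   | S , S∈ , refl =
    s≤s (omitsSome-depth S (profiles-depth (tests n) (tests-depth n) ∘ ∈-sublists⇒⊆ S∈))

  characters-depth : ∀ n → DepthBounded n (characters n)
  characters-depth n = profiles-depth (tests n) (tests-depth n)

  atom∈tests : ∀ n p → atom p ∈ tests n
  atom∈tests zero p = ∈-map⁺ atom (∈-allFin p)
  atom∈tests (suc n) p = ∈-++⁺ˡ (atom∈tests zero p)

  ⊞omitsSome∈tests : ∀ n {S} → S ∈ sublists (characters n) → ⊞ omitsSome S ∈ tests (suc n)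
  ⊞omitsSome∈tests n S∈ = ∈-++⁺ʳ atoms (∈-map⁺ (⊞_ ∘ omitsSome) S∈)

  profile-transfer : ∀ (M M′ : Model k) L {w w′ χ φ} → χ ∈ profiles L →
                     M , ⟦ w ⟧ ⊨ χ → M′ , ⟦ w′ ⟧ ⊨ χ → φ ∈ L → M , ⟦ w ⟧ ⊨ φ → M′ , ⟦ w′ ⟧ ⊨ φ
  profile-transfer M M′ (ψ ∷ L) χ∈ wχ w′χ φ∈ wφ
    with ∈-cartesianProductWith⁻ _∧ᶠ_ (literals ψ) (profiles L) χ∈ | φ∈
  ... | _ , _ , here refl , _ , refl | here refl = proj₁ w′χ
  ... | _ , _ , there (here refl) , _ , refl | here refl = ⊥-elim (⊨¬-elim M (proj₁ wχ) refl wφ)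
  ... | _ , _ , _ , χ₀∈ , refl | there φ∈L =
    profile-transfer M M′ L χ₀∈ (proj₂ wχ) (proj₂ w′χ) φ∈L wφ

  omitsSome-omits : ∀ (M : Model k) S {t} → M , t ⊨ omitsSome S → ¬ (M , t ⊨ falsum) →
                    ∃ λ χ → χ ∈ S × ∀ x → t x → ¬ (M , ⟦ x ⟧ ⊨ χ)
  omitsSome-omits M [] t⊨⊥ t⊭⊥ = ⊥-elim (t⊭⊥ t⊨⊥)
  omitsSome-omits M (χ ∷ S) (inj₁ t⊨¬χ) _ = χ , here refl , λ x tx → ⊨¬-elim M t⊨¬χ tx
  omitsSome-omits M (χ ∷ S) (inj₂ t⊨) t⊭⊥ with omitsSome-omits M S t⊨ t⊭⊥
  ... | χ′ , χ′∈ , omitted = χ′ , there χ′∈ , omitted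

  Forth : ℕ → (M M′ : Model k) → State (W M) → State (W M′) → Set₁
  Forth n M M′ s s′ = ∀ x → s x → ∃ λ x′ → s′ x′ × WinWorld n M M′ x x′

  WinWorld-sym : ∀ n {M M′ : Model k} {w w′} → WinWorld n M M′ w w′ → WinWorld n M′ M w′ w
  WinState-sym : ∀ n {M M′ : Model k} {s s′} → WinState n M M′ s s′ → WinState n M′ M s′ s
  WinWorld-sym zero (lift agree) = lift (⇔-sym ∘ agree)
  WinWorld-sym (suc n) (lift agree , forth , back) =
    lift (⇔-sym ∘ agree) ,
    (λ s′ hs′ → let s , hs , B = back s′ hs′ in s , hs , WinState-sym n B) ,
    (λ s hs → let s′ , hs′ , B = forth s hs in s′ , hs′ , WinState-sym n B)
  WinState-sym n (forth , back) =
    (λ x′ s′x′ → let x , sx , B = back x′ s′x′ in x , sx , WinWorld-sym n B) ,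
    (λ x sx → let x′ , s′x′ , B = forth x sx in x′ , s′x′ , WinWorld-sym n B)

  WinState-intro : ∀ {n} {M M′ : Model k} {s s′} →
                   Forth n M M′ s s′ → Forth n M′ M s′ s → WinState n M M′ s s′
  WinState-intro {n} forth back =
    forth , λ x′ s′x′ → let x , sx , B = back x′ s′x′ in x , sx , WinWorld-sym n B

  WinWorld⇒AtomAgree : ∀ n {M M′ : Model k} {w w′} → WinWorld n M M′ w w′ → AtomAgree M M′ w w′
  WinWorld⇒AtomAgree zero (lift agree) = agree
  WinWorld⇒AtomAgree (suc n) (lift agree , _) = agree

  WinWorld⇒Forth-σ : ∀ n {M M′ : Model k} {w w′} →
                     WinWorld (suc n) M M′ w w′ → Forth n M M′ (σ M w) (σ M′ w′)
  WinWorld⇒Forth-σ n {M} {M′} {w} {w′} (_ , forth , _) x σx =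
    let t , ht , tx = Equivalence.to (σ-def M w x) σx
        t′ , ht′ , t-forth , _ = forth t ht
        x′ , t′x′ , B = t-forth x tx
    in x′ , Equivalence.from (σ-def M′ w′ x′) (t′ , ht′ , t′x′) , B

  WinWorld⇒WinState-σ : ∀ n {M M′ : Model k} {w w′} →
                        WinWorld (suc n) M M′ w w′ → WinState n M M′ (σ M w) (σ M′ w′)
  WinWorld⇒WinState-σ n B =
    WinState-intro (WinWorld⇒Forth-σ n B) (WinWorld⇒Forth-σ n (WinWorld-sym (suc n) B))

  WinWorld⇒WinState-⟦⟧ : ∀ n {M M′ : Model k} {w w′} →
                         WinWorld n M M′ w w′ → WinState n M M′ ⟦ w ⟧ ⟦ w′ ⟧
  WinWorld⇒WinState-⟦⟧ n {w = w} {w′} B =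
    (λ { _ refl → w′ , refl , B }) , (λ { _ refl → w , refl , B })

module Classical (em : ExcludedMiddle (lsuc 0ℓ)) {k : ℕ} where

  -- States are Set-valued, so a Set₁-valued condition (such as bisimilarity) is turned into a
  -- state through its decision.
  ⟪_⟫ : ∀ {A : Set} → (A → Set₁) → State A
  ⟪ P ⟫ x = True (em {P x})

  ⊨-invariant : ∀ φ {n} {M M′ : Model k} {s s′} →
                md φ ≤ n → WinState n M M′ s s′ → M , s ⊨ φ → M′ , s′ ⊨ φ
  ⊨-invariant (atom p) {n} _ (_ , back) (lift s⊆p) = lift λ x′ s′x′ →
    let x , sx , B = back x′ s′x′ in Equivalence.to (WinWorld⇒AtomAgree n B p) (s⊆p x sx)
  ⊨-invariant falsum _ (_ , back) (lift s⊆∅) = lift λ x′ s′x′ →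
    let x , sx , _ = back x′ s′x′ in s⊆∅ x sx
  ⊨-invariant (φ ∧ᶠ ψ) d B (sφ , sψ) =
    ⊨-invariant φ (m⊔n≤o⇒m≤o (md φ) (md ψ) d) B sφ , ⊨-invariant ψ (m⊔n≤o⇒n≤o (md φ) (md ψ) d) B sψ
  ⊨-invariant (φ ⩒ ψ) d B (inj₁ sφ) = inj₁ (⊨-invariant φ (m⊔n≤o⇒m≤o (md φ) (md ψ) d) B sφ)
  ⊨-invariant (φ ⩒ ψ) d B (inj₂ sψ) = inj₂ (⊨-invariant ψ (m⊔n≤o⇒n≤o (md φ) (md ψ) d) B sψ)
  ⊨-invariant (φ ⇒ᶠ ψ) {n} {M} {M′} {s} d (_ , back) s⊨ t′ t′⊆s′ t′φ =
    ⊨-invariant ψ (m⊔n≤o⇒n≤o (md φ) (md ψ) d) Bt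
      (s⊨ t (λ _ → proj₁) (⊨-invariant φ (m⊔n≤o⇒m≤o (md φ) (md ψ) d) (WinState-sym n Bt) t′φ))
    where
      t : State (W M)
      t = s ∩ ⟪ (λ x → ∃ λ x′ → t′ x′ × WinWorld n M M′ x x′) ⟫
      Bt : WinState n M M′ t t′
      Bt = (λ _ tx → toWitness (proj₂ tx)) ,
           (λ x′ t′x′ → let x , sx , B = back x′ (t′⊆s′ x′ t′x′)
                        in x , (sx , fromWitness (x′ , t′x′ , B)) , B)
  ⊨-invariant (□ φ) {suc n} (s≤s d) (_ , back) s⊨ w′ s′w′ =
    let w , sw , B = back w′ s′w′ in ⊨-invariant φ d (WinWorld⇒WinState-σ n B) (s⊨ w sw)
  ⊨-invariant (⊞ φ) {suc n} (s≤s d) (_ , back) s⊨ w′ s′w′ t′ ht′ =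
    let w , sw , _ , _ , B-back = back w′ s′w′
        t , ht , Bt = B-back t′ ht′
    in ⊨-invariant φ d Bt (s⊨ w sw t ht)

  ⊨-or-⊨¬ : ∀ (M : Model k) φ w → (M , ⟦ w ⟧ ⊨ φ) ⊎ (M , ⟦ w ⟧ ⊨ ¬ᶠ φ)
  ⊨-or-⊨¬ M φ w with em {M , ⟦ w ⟧ ⊨ φ}
  ... | yes wφ = inj₁ wφ
  ... | no w⊭φ = inj₂ (⊨¬-intro M λ { _ refl → w⊭φ })

  ⊭¬-elim : ∀ (M : Model k) {t φ} → ¬ (M , t ⊨ ¬ᶠ φ) → ∃ λ y → t y × M , ⟦ y ⟧ ⊨ φ
  ⊭¬-elim M t⊭¬φ = decidable-stable em λ none → t⊭¬φ (⊨¬-intro M λ y ty yφ → none (y , ty , yφ))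

  ⊭⊞-elim : ∀ (M : Model k) {w φ} → ¬ (M , ⟦ w ⟧ ⊨ (⊞ φ)) → ∃ λ t → Σw M w t × ¬ (M , t ⊨ φ)
  ⊭⊞-elim M w⊭ = decidable-stable em λ none →
    w⊭ λ { _ refl t ht → decidable-stable em λ t⊭ → none (t , ht , t⊭) }

  ∃-profile : ∀ (M : Model k) L w → ∃ λ χ → χ ∈ profiles L × M , ⟦ w ⟧ ⊨ χ
  ∃-profile M [] w = ⊤ᶠ , here refl , λ _ _ t⊨⊥ → t⊨⊥
  ∃-profile M (ψ ∷ L) w with ∃-profile M L w
  ... | χ , χ∈ , wχ with ⊨-or-⊨¬ M ψ w
  ...   | inj₁ wψ  = ψ ∧ᶠ χ , ∈-profiles⁺ L (here refl) χ∈ , wψ , wχ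
  ...   | inj₂ w¬ψ = (¬ᶠ ψ) ∧ᶠ χ , ∈-profiles⁺ L (there (here refl)) χ∈ , w¬ψ , wχ

  Realises : (M : Model k) → State (W M) → Form k → Set₁
  Realises M t χ = ∃ λ y → t y × M , ⟦ y ⟧ ⊨ χ

  realised : (M : Model k) → State (W M) → List (Form k) → List (Form k)
  realised M s = filter (λ χ → em {Realises M s χ})

  realised-⊭omitsSome : ∀ (M : Model k) {s} L →
                        ¬ (M , s ⊨ falsum) → ¬ (M , s ⊨ omitsSome (realised M s L))
  realised-⊭omitsSome M {s} L s⊭⊥ s⊨ with omitsSome-omits M (realised M s L) s⊨ s⊭⊥
  ... | χ , χ∈ , omitted with ∈-filter⁻ (λ χ → em {Realises M s χ}) {xs = L} χ∈
  ...   | _ , y , sy , yχ = omitted y sy yχ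

  ⊭omitsSome⇒realises : ∀ (M : Model k) S {t} → ¬ (M , t ⊨ omitsSome S) →
                        ∀ {χ} → χ ∈ S → Realises M t χ
  ⊭omitsSome⇒realises M (χ ∷ S) t⊭ (here refl) = ⊭¬-elim M (t⊭ ∘ inj₁)
  ⊭omitsSome⇒realises M (χ ∷ S) t⊭ (there χ∈) = ⊭omitsSome⇒realises M S (t⊭ ∘ inj₂) χ∈

  SharedCharacter : ℕ → (M M′ : Model k) → W M → W M′ → Set₁
  SharedCharacter n M M′ w w′ = ∃ λ χ → χ ∈ characters n × M , ⟦ w ⟧ ⊨ χ × M′ , ⟦ w′ ⟧ ⊨ χ

  SharedCharacter-sym : ∀ {n} {M M′ : Model k} {w w′} →
                        SharedCharacter n M M′ w w′ → SharedCharacter n M′ M w′ w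
  SharedCharacter-sym (χ , χ∈ , wχ , w′χ) = χ , χ∈ , w′χ , wχ

  SharedCharacter-transfer : ∀ n {M M′ : Model k} {w w′ φ} → SharedCharacter n M M′ w w′ →
                             φ ∈ tests n → M , ⟦ w ⟧ ⊨ φ → M′ , ⟦ w′ ⟧ ⊨ φ
  SharedCharacter-transfer n {M} {M′} (χ , χ∈ , wχ , w′χ) =
    profile-transfer M M′ (tests n) χ∈ wχ w′χ

  SharedCharacter⇒AtomAgree : ∀ n {M M′ : Model k} {w w′} →
                              SharedCharacter n M M′ w w′ → AtomAgree M M′ w w′
  SharedCharacter⇒AtomAgree n shared p =
    mk⇔ (atom-transfer shared) (atom-transfer (SharedCharacter-sym {n} shared))
    where
      atom-transfer : ∀ {N N′ : Model k} {v v′} → SharedCharacter n N N′ v v′ → V N p v → V N′ p v′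
      atom-transfer {v′ = v′} sh vp =
        lower (SharedCharacter-transfer n sh (atom∈tests n p) (lift (⟦⟧⊆ vp))) v′ refl

  satisfyingSome : (M : Model k) → State (W M) → List (Form k) → State (W M)
  satisfyingSome M t S = t ∩ ⟪ (λ x → ∃ λ χ → χ ∈ S × M , ⟦ x ⟧ ⊨ χ) ⟫

  WinState-realised : ∀ n {M M′ : Model k} {s t′} →
    (∀ {x x′} → SharedCharacter n M M′ x x′ → WinWorld n M M′ x x′) →
    (∀ {χ} → χ ∈ realised M s (characters n) → Realises M′ t′ χ) →
    WinState n M M′ s (satisfyingSome M′ t′ (realised M s (characters n)))
  WinState-realised n {M} {M′} {s} {t′} IH t′-realises = forth , back
    where
      S : List (Form k)
      S = realised M s (characters n)

      forth : Forth n M M′ s (satisfyingSome M′ t′ S)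
      forth x sx =
        let χ , χ∈ , xχ = ∃-profile M (tests n) x
            χ∈S = ∈-filter⁺ (λ χ → em {Realises M s χ}) χ∈ (x , sx , xχ)
            y′ , t′y′ , y′χ = t′-realises χ∈S
        in y′ , (t′y′ , fromWitness (χ , χ∈S , y′χ)) , IH (χ , χ∈ , xχ , y′χ)

      back : ∀ x′ → satisfyingSome M′ t′ S x′ → ∃ λ x → s x × WinWorld n M M′ x x′
      back x′ (_ , x′-satisfies) =
        let χ , χ∈S , x′χ = toWitness x′-satisfies
            χ∈ , y , sy , yχ = ∈-filter⁻ (λ χ → em {Realises M s χ}) χ∈S
        in y , sy , IH (χ , χ∈ , yχ , x′χ)

  SharedCharacter⇒answer : ∀ n {M M′ : Model k} {w w′} →
    (∀ {x x′} → SharedCharacter n M M′ x x′ → WinWorld n M M′ x x′) →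
    SharedCharacter (suc n) M M′ w w′ →
    ∀ s → Σw M w s → ∃ λ s′ → Σw M′ w′ s′ × WinState n M M′ s s′
  SharedCharacter⇒answer n {M} {M′} {w} {w′} IH shared s hs with em {M , s ⊨ falsum}
  ... | yes (lift s-empty) = ∅ , Σ-∅ M′ w′ , (λ x sx → ⊥-elim (s-empty x sx)) , λ _ ()
  ... | no s⊭⊥ =
    let t′ , ht′ , t′⊭ = ⊭⊞-elim M′ w′⊭
    in satisfyingSome M′ t′ S , Σ-downward M′ w′ t′ _ (λ _ → proj₁) ht′ ,
       WinState-realised n IH (⊭omitsSome⇒realises M′ S t′⊭)
    where
      S : List (Form k)
      S = realised M s (characters n)

      w⊭ : ¬ (M , ⟦ w ⟧ ⊨ (⊞ omitsSome S))
      w⊭ w⊨ = realised-⊭omitsSome M (characters n) s⊭⊥ (w⊨ w refl s hs)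

      w′⊭ : ¬ (M′ , ⟦ w′ ⟧ ⊨ (⊞ omitsSome S))
      w′⊭ = w⊭ ∘ SharedCharacter-transfer (suc n) (SharedCharacter-sym {suc n} shared)
                   (⊞omitsSome∈tests n (filter∈sublists _ (characters n)))

  SharedCharacter⇒WinWorld : ∀ n {M M′ : Model k} {w w′} →
                             SharedCharacter n M M′ w w′ → WinWorld n M M′ w w′
  SharedCharacter⇒WinWorld zero shared = lift (SharedCharacter⇒AtomAgree zero shared)
  SharedCharacter⇒WinWorld (suc n) shared =
    lift (SharedCharacter⇒AtomAgree (suc n) shared) ,
    SharedCharacter⇒answer n (SharedCharacter⇒WinWorld n) shared ,
    λ s′ hs′ → let s , hs , B = SharedCharacter⇒answer n (SharedCharacter⇒WinWorld n)
                                  (SharedCharacter-sym {suc n} shared) s′ hs′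
               in s , hs , WinState-sym n B

  Bisim⇒≡InqML-state : ∀ n {M M′ : Model k} {s s′} →
                       Bisim-state n M M′ s s′ → ≡InqML-state n M M′ s s′
  Bisim⇒≡InqML-state n B φ d = mk⇔ (⊨-invariant φ d B) (⊨-invariant φ d (WinState-sym n B))

  ≡InqML⇒Forth : ∀ n {M M′ : Model k} {s s′} → ≡InqML-state n M M′ s s′ → Forth n M M′ s s′
  ≡InqML⇒Forth n {M} {M′} E x sx =
    let χ , χ∈ , xχ = ∃-profile M (tests n) x
        s′⊭¬χ = λ s′⊨¬χ →
          ⊨¬-elim M (Equivalence.from (E (¬ᶠ χ) (md-¬ χ (characters-depth n χ∈))) s′⊨¬χ) sx xχ
        x′ , s′x′ , x′χ = ⊭¬-elim M′ s′⊭¬χ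
    in x′ , s′x′ , SharedCharacter⇒WinWorld n (χ , χ∈ , xχ , x′χ)

  ≡InqML⇒Bisim-state : ∀ n {M M′ : Model k} {s s′} →
                       ≡InqML-state n M M′ s s′ → Bisim-state n M M′ s s′
  ≡InqML⇒Bisim-state n E =
    WinState-intro (≡InqML⇒Forth n E) (≡InqML⇒Forth n (λ φ d → ⇔-sym (E φ d)))

  Bisim⇒≡InqML-world : ∀ n {M M′ : Model k} {w w′} →
                       Bisim-world n M M′ w w′ → ≡InqML-world n M M′ w w′
  Bisim⇒≡InqML-world n B = Bisim⇒≡InqML-state n (WinWorld⇒WinState-⟦⟧ n B)

  ≡InqML⇒Bisim-world : ∀ n {M M′ : Model k} {w w′} →
                       ≡InqML-world n M M′ w w′ → Bisim-world n M M′ w w′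
  ≡InqML⇒Bisim-world n {M} {w = w} E =
    let χ , χ∈ , wχ = ∃-profile M (tests n) w
    in SharedCharacter⇒WinWorld n (χ , χ∈ , wχ , Equivalence.to (E χ (characters-depth n χ∈)) wχ)

theorem4p1 : ExcludedMiddle (lsuc 0ℓ) →
    (k n : ℕ) (M M′ : Model k) →
    (∀ (s : State (W M)) (s′ : State (W M′)) →
      Bisim-state n M M′ s s′ ⇔ ≡InqML-state n M M′ s s′)
    × (∀ (w : W M) (w′ : W M′) →
      Bisim-world n M M′ w w′ ⇔ ≡InqML-world n M M′ w w′)
theorem4p1 em k n M M′ =
  (λ _ _ → mk⇔ (Bisim⇒≡InqML-state n) (≡InqML⇒Bisim-state n)) ,
  (λ _ _ → mk⇔ (Bisim⇒≡InqML-world n) (≡InqML⇒Bisim-world n))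
  where open Classical em {k}
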